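{- Let $G$ be a connected graph with root vertex $r$. If for any two vertices $u,v$ of $G$ there exists a median of $u$, $v$ and $r$, then every daisy graph of $G$ with respect to $r$ is an isometric subgraph of $G$.
   Context: A median of vertices $u,v,w$ is a vertex lying on some shortest $u,v$-path, on some shortest $u,w$-path and on some shortest $v,w$-path. For a connected graph $G$ rooted at $r$, $u\le_{G,r}v$ means that $u$ lies on some shortest $v,r$-path; for $X\subseteq V(G)$ the daisy graph $G_r(X)$ is the subgraph of $G$ induced by $\{u: u\le_{G,r}v\text{ for some }v\in X\}$. A subgraph $H$ is isometric if $d_H(u,v)=d_G(u,v)$ for all $u,v\in V(H)$. -}

module Defs where

open import Data.Nat using (ℕ; zero; suc; _+_; _≤_)
open import Data.Fin using (Fin)
open import Data.Unit using (⊤)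
open import Data.Product using (Σ; ∃; ∃-syntax; _×_)
open import Relation.Nullary using (¬_; Dec)
open import Relation.Binary.PropositionalEquality using (_≡_)

record Graph (n : ℕ) : Set₁ where
  field
    Adj     : Fin n → Fin n → Set
    adj?    : ∀ u v → Dec (Adj u v)
    sym     : ∀ {u v} → Adj u v → Adj v u
    irrefl  : ∀ {u} → ¬ Adj u u

module _ {n : ℕ} (G : Graph n) where
  open Graph G

  data WalkIn (P : Fin n → Set) : Fin n → Fin n → ℕ → Set where
    here : ∀ {u} → P u → WalkIn P u u zero
    step : ∀ {u w v k} → P u → Adj u w → WalkIn P w v k → WalkIn P u v (suc k)

  Walk : Fin n → Fin n → ℕ → Set
  Walk = WalkIn (λ _ → ⊤)

  -- d_H(u,v) = k for the subgraph H of G induced by the vertex set P.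
  DistIn : (Fin n → Set) → Fin n → Fin n → ℕ → Set
  DistIn P u v k = WalkIn P u v k × (∀ m → WalkIn P u v m → k ≤ m)

  Dist : Fin n → Fin n → ℕ → Set
  Dist = DistIn (λ _ → ⊤)

  Connected : Set
  Connected = ∀ u v → ∃[ k ] Walk u v k

  -- w lies on some shortest u,v-path: there is a u,v-walk of length d(u,v)
  -- passing through w (such a walk is necessarily a path).
  OnGeodesic : Fin n → Fin n → Fin n → Set
  OnGeodesic u w v =
    ∃[ a ] ∃[ b ] ∃[ d ] (Walk u w a × Walk w v b × Dist u v d × a + b ≡ d)

  IsMedian : Fin n → Fin n → Fin n → Fin n → Set
  IsMedian u v w m = OnGeodesic u m v × OnGeodesic u m w × OnGeodesic v m w

  _≤[_]_ : Fin n → Fin n → Fin n → Set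
  u ≤[ r ] v = OnGeodesic v u r

  DaisyVertex : Fin n → (Fin n → Set) → Fin n → Set
  DaisyVertex r X u = ∃[ v ] (X v × u ≤[ r ] v)

  IsometricInduced : (Fin n → Set) → Set
  IsometricInduced P = ∀ u v → P u → P v → ∀ k → Dist u v k → DistIn P u v k

module Submission where

-- Call a vertex set P *closed towards r* if x ∈ P and y lying on
-- a shortest x,r-path imply y ∈ P.  Daisy vertex sets are closed towards r,
-- because "lies on a shortest path to r" is transitive.  Given u, v in such a
-- set, take a median m of u, v, r.  Every shortest u,r-path through m stays
-- inside the set (each of its vertices lies on a shortest u,r-path), so its
-- u,m-segment is a walk in the set of length d(u,m); likewise for v.  Since m
-- lies on a shortest u,v-path, d(u,m) + d(m,v) = d(u,v), and gluing the two
-- segments gives a u,v-walk inside the set of length d(u,v).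

open import Defs
open import Data.Nat using (ℕ; suc; _+_; _≤_)
open import Data.Nat.Properties
open import Data.Fin using (Fin)
open import Data.Unit using (tt)
open import Data.Product using (∃-syntax; _,_; proj₁; proj₂)
open import Relation.Binary.PropositionalEquality

module Geodesics {n : ℕ} (G : Graph n) where
  open Graph G using () renaming (sym to adj-sym)

  walk-start : ∀ {P u v k} → WalkIn G P u v k → P u
  walk-start (here p)     = p
  walk-start (step p _ _) = p

  to-walk : ∀ {P u v k} → WalkIn G P u v k → Walk G u v k
  to-walk (here _)     = here tt
  to-walk (step _ a w) = step tt a (to-walk w)

  _++_ : ∀ {P u w v a b} → WalkIn G P u w a → WalkIn G P w v b → WalkIn G P u v (a + b)
  here _     ++ q = q
  step p a w ++ q = step p a (w ++ q)

  reverse : ∀ {P u v k} → WalkIn G P u v k → WalkIn G P v u k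
  reverse {P} {u} {v} {k} p = subst (WalkIn G P v u) (+-identityʳ k) (rev-onto p (here (walk-start p)))
    where
    rev-onto : ∀ {w v x a b} → WalkIn G P w v a → WalkIn G P w x b → WalkIn G P v x (a + b)
    rev-onto (here _) acc = acc
    rev-onto {x = x} {b = b} (step {k = k} _ adj p) acc =
      subst (WalkIn G P _ x) (+-suc k b) (rev-onto p (step (walk-start p) (adj-sym adj) acc))

  dist-in : ∀ {P u v k} → WalkIn G P u v k → Dist G u v k → DistIn G P u v k
  dist-in p d = p , λ m q → proj₂ d m (to-walk q)

  dist-unique : ∀ {u v d d'} → Dist G u v d → Dist G u v d' → d ≡ d'
  dist-unique D D' = ≤-antisym (proj₂ D _ (proj₁ D')) (proj₂ D' _ (proj₁ D))

  dist-sym : ∀ {u v d} → Dist G u v d → Dist G v u d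
  dist-sym (p , min) = reverse p , λ m q → min m (reverse q)

  geodesic-prefix : ∀ {u m v a b d} → Walk G u m a → Walk G m v b →
                    Dist G u v d → a + b ≡ d → Dist G u m a
  geodesic-prefix {a = a} {b} p q D e =
    p , λ j s → +-cancelʳ-≤ b a j (subst (_≤ j + b) (sym e) (proj₂ D _ (s ++ q)))

  geodesic-suffix : ∀ {u m v a b d} → Walk G u m a → Walk G m v b →
                    Dist G u v d → a + b ≡ d → Dist G m v b
  geodesic-suffix {a = a} {b} p q D e =
    q , λ j s → +-cancelˡ-≤ a b j (subst (_≤ a + j) (sym e) (proj₂ D _ (p ++ s)))

  ≤-root-trans : ∀ {x u w r} → OnGeodesic G u x r → OnGeodesic G w u r → OnGeodesic G w x r
  ≤-root-trans (c , e , d' , s , t , D' , e') (a , b , d , p , q , D , e-ab) =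
    a + c , e , d , p ++ s , t , D ,
    ≤-antisym length-≤ (proj₂ D _ ((p ++ s) ++ t))
    where
    length-≤ : a + c + e ≤ d
    length-≤ = begin
      a + c + e   ≡⟨ +-assoc a c e ⟩
      a + (c + e) ≡⟨ cong (a +_) e' ⟩
      a + d'      ≤⟨ +-monoʳ-≤ a (proj₂ D' b q) ⟩
      a + b       ≡⟨ e-ab ⟩
      d           ∎
      where open ≤-Reasoning

  ClosedTowards : Fin n → (Fin n → Set) → Set
  ClosedTowards r P = ∀ {x y} → P x → OnGeodesic G x y r → P y

  daisy-closed : ∀ r X → ClosedTowards r (DaisyVertex G r X)
  daisy-closed r X (x , Xx , y≤x) z≤y = x , Xx , ≤-root-trans z≤y y≤x

  geodesic-to-root-inside : ∀ {r P w m a c d} → ClosedTowards r P →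
    Walk G w m a → Walk G m r c → Dist G w r d → a + c ≡ d → P w → WalkIn G P w m a
  geodesic-to-root-inside closed (here _) q D e Pw = here Pw
  geodesic-to-root-inside {r} {w = w} {a = suc a'} {c} {d} closed (step _ adj p) q D e Pw =
    step Pw adj (geodesic-to-root-inside closed p q D' refl (closed Pw next≤w))
    where
    one-step : Walk G _ _ 1
    one-step = step tt adj (here tt)
    through-next : 1 + (a' + c) ≡ d
    through-next = trans (sym (+-assoc 1 a' c)) e
    D' : Dist G _ r (a' + c)
    D' = geodesic-suffix one-step (p ++ q) D through-next
    next≤w : OnGeodesic G w _ r
    next≤w = 1 , a' + c , d , one-step , p ++ q , D , through-next

proposition4p6 : ∀ {n : ℕ} (G : Graph n) (r : Fin n) →
    Connected G →
    (∀ u v → ∃[ m ] IsMedian G u v r m) →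
    ∀ (X : Fin n → Set) → IsometricInduced G (DaisyVertex G r X)
proposition4p6 G r _ median X u v Du Dv k dk
  with median u v
... | m , (a , b , _ , um , mv , Duv , a+b) , (a' , _ , _ , um' , mr , Dur , e-u)
        , (b' , _ , _ , vm , mr' , Dvr , e-v) =
  dist-in (subst (WalkIn G D u v) length (u-to-m ++ reverse v-to-m)) dk
  where
  D : Fin _ → Set
  D = DaisyVertex G r X
  open Geodesics G
  u-to-m : WalkIn G D u m a'
  u-to-m = geodesic-to-root-inside (daisy-closed r X) um' mr Dur e-u Du
  v-to-m : WalkIn G D v m b'
  v-to-m = geodesic-to-root-inside (daisy-closed r X) vm mr' Dvr e-v Dv
  -- Their lengths are d(u,m) and d(v,m), which add up to d(u,v) = k.
  a≡a' : a ≡ a'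
  a≡a' = dist-unique (geodesic-prefix um mv Duv a+b) (geodesic-prefix um' mr Dur e-u)
  b≡b' : b ≡ b'
  b≡b' = dist-unique (dist-sym (geodesic-suffix um mv Duv a+b)) (geodesic-prefix vm mr' Dvr e-v)
  length : a' + b' ≡ k
  length = begin
    a' + b' ≡⟨ cong₂ _+_ (sym a≡a') (sym b≡b') ⟩
    a + b   ≡⟨ a+b ⟩
    _       ≡⟨ dist-unique Duv dk ⟩
    k       ∎
    where open ≡-Reasoning
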